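{- Let $s\ge 2$ and $l\ge 1$ be integers, and let $H$ be an $s$-uniform 2-colorable hypergraph on $t$ vertices with \[ t<\frac14\left(1+s^{1/l}\right)^l. \] Then $\operatorname{ch}(H)\le l$.
   Context: A hypergraph $H=(V,E)$ has finite vertex set $V$ and edge set $E\subset 2^V$; it is $s$-uniform if every edge has exactly $s$ vertices. A coloring is proper if every edge contains two vertices of different colors; $H$ is 2-colorable if it has a proper coloring with 2 colors. $H$ is $k$-choosable if for every assignment of lists $L(v)$ of colors with $|L(v)|=k$ for all $v$ there is a proper coloring assigning each $v$ a color from $L(v)$; $\operatorname{ch}(H)$ is the minimum such $k$. -}

module Defs where

open import Level using (0ℓ)
open import Data.Nat using (ℕ; suc; _+_; _*_; _^_; _≤_; _<_)
open import Data.Fin using (Fin)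
open import Data.Fin.Subset as S using (Subset)
open import Data.List using (List; length)
open import Data.List.Relation.Unary.Unique.Propositional using (Unique)
import Data.List.Membership.Propositional as LM
open import Data.Product using (Σ; ∃; ∃-syntax; _×_)
open import Relation.Binary.PropositionalEquality using (_≡_; _≢_)

record Hypergraph (t : ℕ) : Set₁ where
  field
    Edge : Subset t → Set
open Hypergraph public

Uniform : ∀ {t} → ℕ → Hypergraph t → Set
Uniform {t} s H = ∀ (e : Subset t) → Edge H e → S.∣ e ∣ ≡ s

Proper : ∀ {t} {C : Set} → Hypergraph t → (Fin t → C) → Set
Proper {t} H c = ∀ (e : Subset t) → Edge H e →
  ∃[ u ] ∃[ v ] (u S.∈ e × v S.∈ e × c u ≢ c v)

TwoColorable : ∀ {t} → Hypergraph t → Set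
TwoColorable {t} H = Σ (Fin t → Fin 2) λ c → Proper H c

ListAssignment : ℕ → ℕ → Set
ListAssignment t k = Σ (Fin t → List ℕ) λ L →
  (∀ v → Unique (L v)) × (∀ v → length (L v) ≡ k)

Choosable : ∀ {t} → Hypergraph t → ℕ → Set
Choosable {t} H k = ∀ (L : Fin t → List ℕ) →
  (∀ v → Unique (L v)) → (∀ v → length (L v) ≡ k) →
  Σ (Fin t → ℕ) λ c → (∀ v → c v LM.∈ L v) × Proper H c

ChLe : ∀ {t} → Hypergraph t → ℕ → Set
ChLe H l = ∃[ k ] (k ≤ l × Choosable H k)

-- The real inequality  t < (1/4)(1 + s^(1/l))^l, i.e. 4t < (1 + s^(1/l))^l,
-- expressed without reals: there is a nonnegative rational q = a/b with
-- q ≤ s^(1/l) (i.e. a^l ≤ s·b^l) and 4t < (1+q)^l (i.e. 4t·b^l < (a+b)^l).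
-- By monotonicity and continuity of x ↦ (1+x)^l this is equivalent.
BoundHolds : (t s l : ℕ) → Set
BoundHolds t s l = ∃[ a ] ∃[ b ]
  (1 ≤ b × a ^ l ≤ s * b ^ l × 4 * t * b ^ l < (a + b) ^ l)

{-# OPTIONS --safe #-}
module Submission where

-- Fix a proper 2-colouring of H, whose classes we call sides, and lists of l colours. Label every
-- colour independently as reserved for side 0 or for side 1 (weight b each) or as shared (weight d),
-- where the bound on t is used with a = b + d, i.e. (b + d)ˡ ≤ s bˡ and 4t bˡ < Tˡ for T = 2b + d.
-- A vertex is stuck if all its colours are reserved for the other side (probability (b / T)ˡ) and
-- forced if none is reserved for its own side (probability ((b + d) / T)ˡ). Hence s · #stuck + #forced
-- has expectation t (s bˡ + (b + d)ˡ) / Tˡ ≤ 2 t s bˡ / Tˡ < s, so some labelling has no stuck vertex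
-- and fewer than s forced ones. Colour each vertex with a colour reserved for its side if it has one
-- and with a shared one otherwise. An edge meets both sides, so if it were monochromatic its colour
-- would be shared and all its s vertices forced, which is impossible.

open import Defs
open import Data.Nat using (ℕ; _≤_)

open import Data.Bool.Base using (Bool; true; false; not; _∧_; _∨_; if_then_else_)
open import Data.Bool.Properties using (not-involutive; not-¬)
open import Data.Empty using (⊥-elim)
open import Data.Fin.Base using (Fin; zero; suc; toℕ)
open import Data.Fin.Patterns using (0F; 1F; 2F)
open import Data.Fin.Properties using (toℕ-injective; all?; ¬∀⟶∃¬)
open import Data.Fin.Subset as Subset using (Subset; inside; outside; ∣_∣)
open import Data.Fin.Subset.Properties using () renaming (_∈?_ to _∈ₛ?_)
open import Data.List.Base using (List; []; _∷_; length; concatMap; allFin)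
open import Data.List.Extrema.Nat using (max; xs≤max)
open import Data.List.Membership.Propositional using (_∈_)
open import Data.List.Membership.Propositional.Properties using (∈-map⁺; ∈-concat⁺′; ∈-allFin)
open import Data.List.Relation.Unary.All as All using (All; _∷_)
open import Data.List.Relation.Unary.AllPairs using (_∷_)
open import Data.List.Relation.Unary.Unique.Propositional using (Unique)
open import Data.Nat.Base using (zero; suc; _+_; _*_; _∸_; _^_; _<_; z≤n; s≤s; NonZero; >-nonZero)
open import Data.Nat.Properties
  using ( _≟_; _<?_; ≤-refl; ≤-reflexive; ≤-trans; ≤-<-trans; <-≤-trans; <-irrefl; ≤-total
        ; ≰⇒>; <⇒≱; ≮⇒≥; m≤m+n; m≤n+m; m≤n*m; m+[n∸m]≡n; m^n≢0
        ; +-comm; +-identityʳ; *-assoc; *-identityʳ; *-zeroʳ; *-distribˡ-+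
        ; +-mono-≤; +-monoʳ-≤; *-monoˡ-≤; *-monoʳ-≤; *-monoˡ-<; *-monoʳ-<; ^-monoˡ-≤
        ; *-cancelˡ-<; *-cancelʳ-<; +-*-semiring; *-commutativeSemigroup; module ≤-Reasoning)
open import Data.Nat.Tactic.RingSolver using (solve-∀)
open import Data.List.Membership.DecPropositional _≟_ using (_∈?_)
open import Data.Product using (Σ-syntax; ∃₂; ∃-syntax; _×_; _,_; proj₁; proj₂)
open import Data.Sum.Base using (_⊎_; inj₁; inj₂)
open import Data.Vec.Base using (Vec; []; _∷_; lookup; here; there)
open import Function.Base using (_∘_)
open import Relation.Binary.Definitions using (DecidableEquality)
open import Relation.Binary.PropositionalEquality
  using (_≡_; _≢_; refl; sym; trans; cong; cong₂; subst; module ≡-Reasoning)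
open import Relation.Nullary using (Dec; yes; no; does)
open import Relation.Nullary.Decidable using (dec-false; _→-dec_)

open import Algebra.Properties.CommutativeSemigroup *-commutativeSemigroup
  using (x∙yz≈y∙xz; xy∙z≈xz∙y; interchange)
open import Algebra.Properties.Semiring.Sum +-*-semiring
  using (sum; sum-syntax; sum-cong-≗; sum-replicate-zero; ∑-distrib-+; ∑-comm; *-distribˡ-sum; *-distribʳ-sum)

⟦_⟧ : Bool → ℕ
⟦ true  ⟧ = 1
⟦ false ⟧ = 0

⟦∧⟧ : ∀ x y → ⟦ x ∧ y ⟧ ≡ ⟦ x ⟧ * ⟦ y ⟧
⟦∧⟧ true  y = sym (+-identityʳ ⟦ y ⟧)
⟦∧⟧ false y = refl

⟦∨⟧-disjoint : ∀ x y → (x ≡ true → y ≡ false) → ⟦ x ∨ y ⟧ ≡ ⟦ x ⟧ + ⟦ y ⟧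
⟦∨⟧-disjoint true  y x⇒¬y = cong (λ y → suc ⟦ y ⟧) (sym (x⇒¬y refl))
⟦∨⟧-disjoint false y _    = refl

does-true⇒ : ∀ {p} {P : Set p} (P? : Dec P) → does P? ≡ true → P
does-true⇒ (yes p) _ = p

∑-const : ∀ n c → ∑[ i < n ] c ≡ n * c
∑-const zero    c = refl
∑-const (suc n) c = cong (c +_) (∑-const n c)

∑-mono-≤ : ∀ {n} {f g : Fin n → ℕ} → (∀ i → f i ≤ g i) → sum f ≤ sum g
∑-mono-≤ {zero}  _   = z≤n
∑-mono-≤ {suc n} f≤g = +-mono-≤ (f≤g zero) (∑-mono-≤ (f≤g ∘ suc))

≤-∑ : ∀ {n} (f : Fin n → ℕ) i → f i ≤ sum f
≤-∑ f zero    = m≤m+n _ _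
≤-∑ f (suc i) = ≤-trans (≤-∑ (f ∘ suc) i) (m≤n+m _ _)

∑-<⇒∃< : ∀ {n} (f g : Fin n → ℕ) → sum f < sum g → ∃[ i ] f i < g i
∑-<⇒∃< {suc n} f g ∑f<∑g with f zero <? g zero
... | yes f₀<g₀ = zero , f₀<g₀
... | no  f₀≮g₀ =
  let i , fi<gi = ∑-<⇒∃< (f ∘ suc) (g ∘ suc)
                    (≰⇒> λ ∑g≤∑f → <⇒≱ ∑f<∑g (+-mono-≤ (≮⇒≥ f₀≮g₀) ∑g≤∑f))
  in suc i , fi<gi

∣∣≤∑ : ∀ {t} (e : Subset t) (f : Fin t → ℕ) →
       (∀ v → v Subset.∈ e → 1 ≤ f v) → ∣ e ∣ ≤ sum f
∣∣≤∑ {zero}  []            f _  = z≤n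
∣∣≤∑ {suc t} (inside  ∷ e) f 1≤f =
  +-mono-≤ (1≤f zero here) (∣∣≤∑ e (f ∘ suc) (λ v v∈e → 1≤f (suc v) (there v∈e)))
∣∣≤∑ {suc t} (outside ∷ e) f 1≤f =
  ≤-trans (∣∣≤∑ e (f ∘ suc) (λ v v∈e → 1≤f (suc v) (there v∈e))) (m≤n+m _ _)

monochromatic-or-split : ∀ {t} {C : Set} → DecidableEquality C →
  (c : Fin t → C) (e : Subset t) (u : Fin t) →
  (∃[ w ] w Subset.∈ e × c w ≢ c u) ⊎ (∀ w → w Subset.∈ e → c w ≡ c u)
monochromatic-or-split {t} _≟ᶜ_ c e u with all? (λ w → w ∈ₛ? e →-dec c w ≟ᶜ c u)
... | yes mono = inj₂ mono
... | no ¬mono with ¬∀⟶∃¬ t _ (λ w → w ∈ₛ? e →-dec c w ≟ᶜ c u) ¬mono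
...   | w , ¬[w∈e⇒cw≡cu] with w ∈ₛ? e
...     | yes w∈e = inj₁ (w , w∈e , λ cw≡cu → ¬[w∈e⇒cw≡cu] λ _ → cw≡cu)
...     | no  w∉e = ⊥-elim (¬[w∈e⇒cw≡cu] λ w∈e → ⊥-elim (w∉e w∈e))

colours-bounded : ∀ {t} (L : Fin t → List ℕ) → ∃[ M ] ∀ v → All (_< M) (L v)
colours-bounded {t} L = suc (max 0 colours) , λ v → All.tabulate λ x∈Lv →
  s≤s (All.lookup (xs≤max 0 colours) (∈-concat⁺′ x∈Lv (∈-map⁺ L (∈-allFin v))))
  where
  colours : List ℕ
  colours = concatMap L (allFin t)

count : ℕ → (ℕ → Bool) → ℕ
count M g = ∑[ i < M ] ⟦ g (toℕ i) ⟧

count-≟ : ∀ {M} y → y < M → count M (λ x → does (x ≟ y)) ≡ 1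
count-≟ {suc M} zero    _         = cong suc (sum-replicate-zero M)
count-≟ {suc M} (suc y) (s≤s y<M) = count-≟ y y<M

count-∈ : ∀ {M} xs → Unique xs → All (_< M) xs → count M (λ x → does (x ∈? xs)) ≡ length xs
count-∈ {M} []       _               _            = sum-replicate-zero M
count-∈ {M} (y ∷ xs) (y∉xs ∷ unique) (y<M ∷ xs<M) = begin
  count M (λ x → does (x ≟ y) ∨ does (x ∈? xs))
    ≡⟨ sum-cong-≗ {M} (λ i → ⟦∨⟧-disjoint _ _ (∉xs (toℕ i))) ⟩
  ∑[ i < M ] (⟦ does (toℕ i ≟ y) ⟧ + ⟦ does (toℕ i ∈? xs) ⟧)
    ≡⟨ ∑-distrib-+ {M} _ _ ⟩
  count M (λ x → does (x ≟ y)) + count M (λ x → does (x ∈? xs))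
    ≡⟨ cong₂ _+_ (count-≟ y y<M) (count-∈ xs unique xs<M) ⟩
  suc (length xs) ∎
  where
  open ≡-Reasoning
  ∉xs : ∀ x → does (x ≟ y) ≡ true → does (x ∈? xs) ≡ false
  ∉xs x x≟y = dec-false (x ∈? xs) λ x∈xs → All.lookup y∉xs x∈xs (sym (does-true⇒ (x ≟ y) x≟y))

allOn : ∀ {A : Set} {M} → (ℕ → Bool) → (A → Bool) → Vec A M → Bool
allOn g S []      = true
allOn g S (k ∷ σ) = (not (g 0) ∨ S k) ∧ allOn (g ∘ suc) S σ

allOn-false : ∀ {A : Set} {M} g S (σ : Vec A M) → allOn g S σ ≡ false →
              ∃[ i ] g (toℕ i) ≡ true × S (lookup σ i) ≡ false
allOn-false g S (k ∷ σ) eq with g 0 in g₀ | S k in Sk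
... | true  | false = zero , g₀ , Sk
... | true  | true  = let i , gi , Si = allOn-false (g ∘ suc) S σ eq in suc i , gi , Si
... | false | _     = let i , gi , Si = allOn-false (g ∘ suc) S σ eq in suc i , gi , Si

module Weighted {q : ℕ} (w : Fin q → ℕ) where

  -- 𝔼 M F is total ^ M times the expectation of F when the M letters of σ are drawn independently,
  -- letter k with probability w k / total; this normalisation keeps the computation inside ℕ.
  𝔼 : ∀ M → (Vec (Fin q) M → ℕ) → ℕ
  𝔼 zero    F = F []
  𝔼 (suc M) F = ∑[ k < q ] (w k * 𝔼 M (λ σ → F (k ∷ σ)))

  total : ℕ
  total = ∑[ k < q ] w k

  mass : (Fin q → Bool) → ℕ
  mass S = ∑[ k < q ] (if S k then w k else 0)

  𝔼-cong : ∀ M {F G} → (∀ σ → F σ ≡ G σ) → 𝔼 M F ≡ 𝔼 M G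
  𝔼-cong zero    F≗G = F≗G []
  𝔼-cong (suc M) F≗G = sum-cong-≗ {q} (λ k → cong (w k *_) (𝔼-cong M (F≗G ∘ (k ∷_))))

  𝔼-distrib-+ : ∀ M F G → 𝔼 M (λ σ → F σ + G σ) ≡ 𝔼 M F + 𝔼 M G
  𝔼-distrib-+ zero    F G = refl
  𝔼-distrib-+ (suc M) F G = begin
    ∑[ k < q ] (w k * 𝔼 M (λ σ → F (k ∷ σ) + G (k ∷ σ)))
      ≡⟨ sum-cong-≗ {q} (λ k → trans (cong (w k *_) (𝔼-distrib-+ M _ _)) (*-distribˡ-+ (w k) _ _)) ⟩
    ∑[ k < q ] (w k * 𝔼 M (F ∘ (k ∷_)) + w k * 𝔼 M (G ∘ (k ∷_)))
      ≡⟨ ∑-distrib-+ {q} _ _ ⟩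
    𝔼 (suc M) F + 𝔼 (suc M) G ∎
    where open ≡-Reasoning

  *-distribˡ-𝔼 : ∀ M c F → c * 𝔼 M F ≡ 𝔼 M (λ σ → c * F σ)
  *-distribˡ-𝔼 zero    c F = refl
  *-distribˡ-𝔼 (suc M) c F = begin
    c * ∑[ k < q ] (w k * 𝔼 M (F ∘ (k ∷_)))   ≡⟨ *-distribˡ-sum {q} c _ ⟩
    ∑[ k < q ] (c * (w k * 𝔼 M (F ∘ (k ∷_)))) ≡⟨ sum-cong-≗ {q} (λ k → x∙yz≈y∙xz c (w k) _) ⟩
    ∑[ k < q ] (w k * (c * 𝔼 M (F ∘ (k ∷_)))) ≡⟨ sum-cong-≗ {q} (λ k → cong (w k *_) (*-distribˡ-𝔼 M c _)) ⟩
    𝔼 (suc M) (λ σ → c * F σ)                 ∎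
    where open ≡-Reasoning

  𝔼-const : ∀ M c → 𝔼 M (λ _ → c) ≡ c * total ^ M
  𝔼-const zero    c = sym (*-identityʳ c)
  𝔼-const (suc M) c = begin
    ∑[ k < q ] (w k * 𝔼 M (λ _ → c))   ≡⟨ sum-cong-≗ {q} (λ k → cong (w k *_) (𝔼-const M c)) ⟩
    ∑[ k < q ] (w k * (c * total ^ M)) ≡⟨ *-distribʳ-sum {q} (c * total ^ M) w ⟨
    total * (c * total ^ M)          ≡⟨ x∙yz≈y∙xz total c (total ^ M) ⟩
    c * total ^ suc M                ∎
    where open ≡-Reasoning

  𝔼-comm-∑ : ∀ M {t} (F : Fin t → Vec (Fin q) M → ℕ) →
             𝔼 M (λ σ → ∑[ v < t ] F v σ) ≡ ∑[ v < t ] 𝔼 M (F v)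
  𝔼-comm-∑ zero    F = refl
  𝔼-comm-∑ (suc M) {t} F = begin
    ∑[ k < q ] (w k * 𝔼 M (λ σ → ∑[ v < t ] F v (k ∷ σ)))
      ≡⟨ sum-cong-≗ {q} (λ k → cong (w k *_) (𝔼-comm-∑ M {t} _)) ⟩
    ∑[ k < q ] (w k * ∑[ v < t ] 𝔼 M (F v ∘ (k ∷_)))
      ≡⟨ sum-cong-≗ {q} (λ k → *-distribˡ-sum {t} (w k) _) ⟩
    ∑[ k < q ] ∑[ v < t ] (w k * 𝔼 M (F v ∘ (k ∷_)))
      ≡⟨ ∑-comm {q} {t} _ ⟩
    ∑[ v < t ] 𝔼 (suc M) (F v) ∎
    where open ≡-Reasoning

  𝔼-<⇒∃< : ∀ M F G → 𝔼 M F < 𝔼 M G → ∃[ σ ] F σ < G σ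
  𝔼-<⇒∃< zero    F G F<G   = [] , F<G
  𝔼-<⇒∃< (suc M) F G 𝔼F<𝔼G =
    let k , wF<wG = ∑-<⇒∃< _ _ 𝔼F<𝔼G
        σ , Fσ<Gσ = 𝔼-<⇒∃< M _ _ (*-cancelˡ-< (w k) _ _ wF<wG)
    in k ∷ σ , Fσ<Gσ

  mass-if : ∀ S b → ∑[ k < q ] (if not b ∨ S k then w k else 0) ≡ (if b then mass S else total)
  mass-if S true  = refl
  mass-if S false = refl

  𝔼-allOn-step : ∀ M g S → 𝔼 (suc M) (λ σ → ⟦ allOn g S σ ⟧) ≡
                 (if g 0 then mass S else total) * 𝔼 M (λ σ → ⟦ allOn (g ∘ suc) S σ ⟧)
  𝔼-allOn-step M g S = begin
    ∑[ k < q ] (w k * 𝔼 M (λ σ → ⟦ (not (g 0) ∨ S k) ∧ allOn (g ∘ suc) S σ ⟧))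
      ≡⟨ sum-cong-≗ {q} (λ k → cong (w k *_) (𝔼-cong M (λ σ → ⟦∧⟧ (not (g 0) ∨ S k) _))) ⟩
    ∑[ k < q ] (w k * 𝔼 M (λ σ → ⟦ not (g 0) ∨ S k ⟧ * ⟦ allOn (g ∘ suc) S σ ⟧))
      ≡⟨ sum-cong-≗ {q} (λ k → cong (w k *_) (*-distribˡ-𝔼 M ⟦ not (g 0) ∨ S k ⟧ _)) ⟨
    ∑[ k < q ] (w k * (⟦ not (g 0) ∨ S k ⟧ * X))
      ≡⟨ sum-cong-≗ {q} (λ k → keep-if (not (g 0) ∨ S k) (w k)) ⟩
    ∑[ k < q ] ((if not (g 0) ∨ S k then w k else 0) * X)
      ≡⟨ *-distribʳ-sum {q} X _ ⟨
    ∑[ k < q ] (if not (g 0) ∨ S k then w k else 0) * X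
      ≡⟨ cong (_* X) (mass-if S (g 0)) ⟩
    (if g 0 then mass S else total) * X ∎
    where
    open ≡-Reasoning
    X = 𝔼 M (λ σ → ⟦ allOn (g ∘ suc) S σ ⟧)
    keep-if : ∀ β x → x * (⟦ β ⟧ * X) ≡ (if β then x else 0) * X
    keep-if true  x = cong (x *_) (+-identityʳ X)
    keep-if false x = *-zeroʳ x

  𝔼-allOn : ∀ M g S →
            𝔼 M (λ σ → ⟦ allOn g S σ ⟧) * total ^ count M g ≡ mass S ^ count M g * total ^ M
  𝔼-allOn zero    g S = refl
  𝔼-allOn (suc M) g S =
    trans (cong (_* total ^ count (suc M) g) (𝔼-allOn-step M g S))
          (peel (g 0) (𝔼-allOn M (g ∘ suc) S))
    where
    peel : ∀ b {X c} → X * total ^ c ≡ mass S ^ c * total ^ M →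
           (if b then mass S else total) * X * total ^ (⟦ b ⟧ + c) ≡
           mass S ^ (⟦ b ⟧ + c) * total ^ suc M
    peel true  {X} {c} IH = begin
      mass S * X * (total * total ^ c)          ≡⟨ interchange (mass S) X total (total ^ c) ⟩
      mass S * total * (X * total ^ c)          ≡⟨ cong (mass S * total *_) IH ⟩
      mass S * total * (mass S ^ c * total ^ M) ≡⟨ interchange (mass S) total (mass S ^ c) (total ^ M) ⟩
      mass S * mass S ^ c * (total * total ^ M) ∎
      where open ≡-Reasoning
    peel false {X} {c} IH = begin
      total * X * total ^ c            ≡⟨ *-assoc total X (total ^ c) ⟩
      total * (X * total ^ c)          ≡⟨ cong (total *_) IH ⟩
      total * (mass S ^ c * total ^ M) ≡⟨ x∙yz≈y∙xz total (mass S ^ c) (total ^ M) ⟩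
      mass S ^ c * (total * total ^ M) ∎
      where open ≡-Reasoning

-- Labels 0F and 1F reserve a colour for the vertices of that side; shared colours serve both sides.
Label : Set
Label = Fin 3

shared : Label
shared = 2F

own foreign : Fin 2 → Label → Bool
own 0F 0F = true
own 1F 1F = true
own _  _  = false
foreign 0F 1F = true
foreign 1F 0F = true
foreign _  _  = false

own-shared : ∀ j → own j shared ≡ false
own-shared 0F = refl
own-shared 1F = refl

own⇒¬foreign : ∀ j ℓ → own j ℓ ≡ true → foreign j ℓ ≡ false
own⇒¬foreign 0F 0F _ = refl
own⇒¬foreign 1F 1F _ = refl

¬foreign⇒shared : ∀ {i j} ℓ → i ≢ j → foreign i ℓ ≡ false → foreign j ℓ ≡ false → ℓ ≡ shared
¬foreign⇒shared {0F} {0F} _  i≢j _  _  = ⊥-elim (i≢j refl)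
¬foreign⇒shared {1F} {1F} _  i≢j _  _  = ⊥-elim (i≢j refl)
¬foreign⇒shared {0F} {1F} 2F _   _  _  = refl
¬foreign⇒shared {1F} {0F} 2F _   _  _  = refl
¬foreign⇒shared {0F} {1F} 0F _   _  ()
¬foreign⇒shared {0F} {1F} 1F _   () _
¬foreign⇒shared {1F} {0F} 0F _   () _
¬foreign⇒shared {1F} {0F} 1F _   _  ()

reservation : ℕ → ℕ → Label → ℕ
reservation b d 0F = b
reservation b d 1F = b
reservation b d 2F = d

module _ (b d : ℕ) where
  open Weighted (reservation b d)

  total-reservation : total ≡ b + (b + d)
  total-reservation = cong (λ x → b + (b + x)) (+-identityʳ d)

  mass-foreign : ∀ j → mass (foreign j) ≡ b
  mass-foreign 0F = +-identityʳ b
  mass-foreign 1F = +-identityʳ b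

  mass-¬own : ∀ j → mass (not ∘ own j) ≡ b + d
  mass-¬own 0F = cong (b +_) (+-identityʳ d)
  mass-¬own 1F = cong (b +_) (+-identityʳ d)

-- Replacing a by max a b keeps both inequalities, so that d = a ∸ b is not truncated and a = b + d.
reservation-parameters : ∀ {t s l} .{{_ : NonZero s}} → BoundHolds t s l →
  ∃₂ λ b d → 1 ≤ b × (b + d) ^ l ≤ s * b ^ l × 4 * t * b ^ l < (b + (b + d)) ^ l
reservation-parameters {t} {s} {l} (a , b , 1≤b , aˡ≤sbˡ , 4tbˡ<[a+b]ˡ) with ≤-total a b
... | inj₁ a≤b = b , 0 , 1≤b ,
  subst (λ x → x ^ l ≤ s * b ^ l) (sym (+-identityʳ b)) (m≤n*m (b ^ l) s) ,
  <-≤-trans 4tbˡ<[a+b]ˡ (^-monoˡ-≤ l (+-mono-≤ a≤b (m≤m+n b 0)))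
... | inj₂ b≤a = b , a ∸ b , 1≤b ,
  subst (λ x → x ^ l ≤ s * b ^ l) (sym (m+[n∸m]≡n b≤a)) aˡ≤sbˡ ,
  subst (λ x → 4 * t * b ^ l < x ^ l)
        (trans (+-comm a b) (cong (b +_) (sym (m+[n∸m]≡n b≤a)))) 4tbˡ<[a+b]ˡ

defect-bound : ∀ {t s l b d} .{{_ : NonZero s}} →
  (b + d) ^ l ≤ s * b ^ l → 4 * t * b ^ l < (b + (b + d)) ^ l →
  t * (s * b ^ l + (b + d) ^ l) < s * (b + (b + d)) ^ l
defect-bound {t} {s} {l} {b} {d} [b+d]ˡ≤sbˡ 4tbˡ<Tˡ = begin-strict
  t * (s * b ^ l + (b + d) ^ l) ≤⟨ *-monoʳ-≤ t (+-monoʳ-≤ (s * b ^ l) [b+d]ˡ≤sbˡ) ⟩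
  t * (s * b ^ l + s * b ^ l)   ≡⟨ regroup t s (b ^ l) ⟩
  s * (2 * t * b ^ l)           <⟨ *-monoʳ-< s (≤-<-trans 2tbˡ≤4tbˡ 4tbˡ<Tˡ) ⟩
  s * (b + (b + d)) ^ l         ∎
  where
  open ≤-Reasoning
  regroup : ∀ t s x → t * (s * x + s * x) ≡ s * (2 * t * x)
  regroup = solve-∀
  2tbˡ≤4tbˡ : 2 * t * b ^ l ≤ 4 * t * b ^ l
  2tbˡ≤4tbˡ = *-monoˡ-≤ (b ^ l) (*-monoˡ-≤ t (m≤m+n 2 2))

-- A labelling σ gives the colour toℕ i < M the label lookup σ i.
module Reservation {t M : ℕ} (side : Fin t → Fin 2) (L : Fin t → List ℕ) where

  marks : Fin t → ℕ → Bool
  marks v x = does (x ∈? L v)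

  stuck forced : Fin t → Vec Label M → Bool
  stuck  v = allOn (marks v) (foreign (side v))
  forced v = allOn (marks v) (not ∘ own (side v))

  defect : ℕ → Vec Label M → ℕ
  defect s σ = ∑[ v < t ] (s * ⟦ stuck v σ ⟧ + ⟦ forced v σ ⟧)

  module LowDefect {s} (σ : Vec Label M) (low : defect s σ < s) where

    stuck-cost : ∀ v → s * ⟦ stuck v σ ⟧ < s
    stuck-cost v = ≤-<-trans (≤-trans (m≤m+n _ _) (≤-∑ _ v)) low

    not-stuck : ∀ v → stuck v σ ≡ false
    not-stuck v with stuck v σ | stuck-cost v
    ... | false | _     = refl
    ... | true  | s*1<s = ⊥-elim (<-irrefl (*-identityʳ s) s*1<s)

    few-forced : ∑[ v < t ] ⟦ forced v σ ⟧ < s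
    few-forced = ≤-<-trans (∑-mono-≤ (λ v → m≤n+m _ (s * ⟦ stuck v σ ⟧))) low

    choice : ∀ v → Σ[ i ∈ Fin M ] toℕ i ∈ L v × foreign (side v) (lookup σ i) ≡ false ×
                                  (own (side v) (lookup σ i) ≡ false → forced v σ ≡ true)
    choice v with forced v σ in forced≡
    ... | false =
      let i , marked , ¬¬own = allOn-false (marks v) (not ∘ own (side v)) σ forced≡
          owned = trans (sym (not-involutive _)) (cong not ¬¬own)
      in i , does-true⇒ (toℕ i ∈? L v) marked , own⇒¬foreign _ _ owned ,
         λ unowned → ⊥-elim (not-¬ owned unowned)
    ... | true =
      let i , marked , ¬foreign = allOn-false (marks v) (foreign (side v)) σ (not-stuck v)
      in i , does-true⇒ (toℕ i ∈? L v) marked , ¬foreign , λ _ → refl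

    colour : Fin t → ℕ
    colour v = toℕ (proj₁ (choice v))

    label : Fin t → Label
    label v = lookup σ (proj₁ (choice v))

    colour-∈ : ∀ v → colour v ∈ L v
    colour-∈ v = proj₁ (proj₂ (choice v))

    same-colour⇒same-label : ∀ {u v} → colour u ≡ colour v → label u ≡ label v
    same-colour⇒same-label = cong (lookup σ) ∘ toℕ-injective

    label-¬foreign : ∀ v → foreign (side v) (label v) ≡ false
    label-¬foreign v = proj₁ (proj₂ (proj₂ (choice v)))

    shared⇒forced : ∀ v → label v ≡ shared → forced v σ ≡ true
    shared⇒forced v label≡shared =
      proj₂ (proj₂ (proj₂ (choice v))) (trans (cong (own (side v)) label≡shared) (own-shared (side v)))

    colour-proper : (H : Hypergraph t) → Uniform s H → Proper H side → Proper H colour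
    colour-proper H uniform side-proper e e∈H with side-proper e e∈H
    ... | u , v , u∈e , v∈e , side-u≢v with monochromatic-or-split _≟_ colour e u
    ...   | inj₁ (w , w∈e , cw≢cu) = w , u , w∈e , u∈e , cw≢cu
    ...   | inj₂ mono = ⊥-elim (<-irrefl (uniform e e∈H) (≤-<-trans ∣e∣≤#forced few-forced))
      where
      label-u-shared : label u ≡ shared
      label-u-shared = ¬foreign⇒shared (label u) side-u≢v (label-¬foreign u)
        (subst (λ ℓ → foreign (side v) ℓ ≡ false) (same-colour⇒same-label (mono v v∈e)) (label-¬foreign v))
      ∣e∣≤#forced : ∣ e ∣ ≤ ∑[ w < t ] ⟦ forced w σ ⟧
      ∣e∣≤#forced = ∣∣≤∑ e _ λ w w∈e → ≤-reflexive (cong ⟦_⟧ (sym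
        (shared⇒forced w (trans (same-colour⇒same-label (mono w w∈e)) label-u-shared))))

  module Expectation {l} (L-unique : ∀ v → Unique (L v)) (L-length : ∀ v → length (L v) ≡ l)
                     (L<M : ∀ v → All (_< M) (L v)) (b d : ℕ) where
    open Weighted (reservation b d)

    𝔼-marked : ∀ S v → 𝔼 M (λ σ → ⟦ allOn (marks v) S σ ⟧) * total ^ l ≡ mass S ^ l * total ^ M
    𝔼-marked S v = subst (λ c → 𝔼 M (λ σ → ⟦ allOn (marks v) S σ ⟧) * total ^ c ≡ mass S ^ c * total ^ M)
      (trans (count-∈ (L v) (L-unique v) (L<M v)) (L-length v)) (𝔼-allOn M (marks v) S)

    𝔼-stuck : ∀ v → 𝔼 M (λ σ → ⟦ stuck v σ ⟧) * total ^ l ≡ b ^ l * total ^ M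
    𝔼-stuck v = trans (𝔼-marked (foreign (side v)) v)
                      (cong (λ x → x ^ l * total ^ M) (mass-foreign b d (side v)))

    𝔼-forced : ∀ v → 𝔼 M (λ σ → ⟦ forced v σ ⟧) * total ^ l ≡ (b + d) ^ l * total ^ M
    𝔼-forced v = trans (𝔼-marked (not ∘ own (side v)) v)
                       (cong (λ x → x ^ l * total ^ M) (mass-¬own b d (side v)))

    𝔼-defect : ∀ s → 𝔼 M (defect s) * total ^ l ≡ t * (s * b ^ l + (b + d) ^ l) * total ^ M
    𝔼-defect s = begin
      𝔼 M (defect s) * total ^ l
        ≡⟨ cong (_* total ^ l) (𝔼-comm-∑ M cost) ⟩
      ∑[ v < t ] 𝔼 M (cost v) * total ^ l
        ≡⟨ *-distribʳ-sum {t} (total ^ l) _ ⟩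
      ∑[ v < t ] (𝔼 M (cost v) * total ^ l)
        ≡⟨ sum-cong-≗ {t} 𝔼-cost ⟩
      ∑[ v < t ] ((s * b ^ l + (b + d) ^ l) * total ^ M)
        ≡⟨ ∑-const t _ ⟩
      t * ((s * b ^ l + (b + d) ^ l) * total ^ M)
        ≡⟨ *-assoc t _ _ ⟨
      t * (s * b ^ l + (b + d) ^ l) * total ^ M ∎
      where
      open ≡-Reasoning
      cost : Fin t → Vec Label M → ℕ
      cost v σ = s * ⟦ stuck v σ ⟧ + ⟦ forced v σ ⟧
      distrib : ∀ s x y z → (s * x + y) * z ≡ s * (x * z) + y * z
      distrib = solve-∀
      𝔼-cost : ∀ v → 𝔼 M (cost v) * total ^ l ≡ (s * b ^ l + (b + d) ^ l) * total ^ M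
      𝔼-cost v = begin
        𝔼 M (cost v) * total ^ l
          ≡⟨ cong (_* total ^ l) (trans (𝔼-distrib-+ M _ _) (cong (_+ _) (sym (*-distribˡ-𝔼 M s _)))) ⟩
        (s * 𝔼 M (λ σ → ⟦ stuck v σ ⟧) + 𝔼 M (λ σ → ⟦ forced v σ ⟧)) * total ^ l
          ≡⟨ distrib s _ _ (total ^ l) ⟩
        s * (𝔼 M (λ σ → ⟦ stuck v σ ⟧) * total ^ l) + 𝔼 M (λ σ → ⟦ forced v σ ⟧) * total ^ l
          ≡⟨ cong₂ (λ x y → s * x + y) (𝔼-stuck v) (𝔼-forced v) ⟩
        s * (b ^ l * total ^ M) + (b + d) ^ l * total ^ M
          ≡⟨ distrib s _ _ (total ^ M) ⟨
        (s * b ^ l + (b + d) ^ l) * total ^ M ∎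

    low-defect-exists : ∀ s .{{_ : NonZero s}} → 1 ≤ b → (b + d) ^ l ≤ s * b ^ l →
                        4 * t * b ^ l < (b + (b + d)) ^ l → ∃[ σ ] defect s σ < s
    low-defect-exists s 1≤b [b+d]ˡ≤sbˡ 4tbˡ<Tˡ =
      𝔼-<⇒∃< M (defect s) (λ _ → s) (*-cancelʳ-< (total ^ l) _ _ 𝔼-defect<𝔼-s)
      where
      instance
        total≢0 : NonZero total
        total≢0 = >-nonZero (subst (0 <_) (sym (total-reservation b d)) (≤-trans 1≤b (m≤m+n b _)))

      expected-defect<s : t * (s * b ^ l + (b + d) ^ l) < s * total ^ l
      expected-defect<s =
        subst (λ x → t * (s * b ^ l + (b + d) ^ l) < s * x ^ l) (sym (total-reservation b d))
              (defect-bound {t} {s} {l} {b} {d} [b+d]ˡ≤sbˡ 4tbˡ<Tˡ)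

      𝔼-defect<𝔼-s : 𝔼 M (defect s) * total ^ l < 𝔼 M (λ _ → s) * total ^ l
      𝔼-defect<𝔼-s = begin-strict
        𝔼 M (defect s) * total ^ l                ≡⟨ 𝔼-defect s ⟩
        t * (s * b ^ l + (b + d) ^ l) * total ^ M <⟨ *-monoˡ-< (total ^ M) {{m^n≢0 total M}} expected-defect<s ⟩
        s * total ^ l * total ^ M                 ≡⟨ xy∙z≈xz∙y s (total ^ l) (total ^ M) ⟩
        s * total ^ M * total ^ l                 ≡⟨ cong (_* total ^ l) (𝔼-const M s) ⟨
        𝔼 M (λ _ → s) * total ^ l                 ∎
        where open ≤-Reasoning

theorem8 : (s l t : ℕ) → 2 ≤ s → 1 ≤ l → (H : Hypergraph t) →
    Uniform s H → TwoColorable H → BoundHolds t s l → ChLe H l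
theorem8 s l t 2≤s _ H uniform (side , side-proper) bound = l , ≤-refl , choosable
  where
  instance
    s≢0 : NonZero s
    s≢0 = >-nonZero (≤-trans (s≤s z≤n) 2≤s)

  choosable : Choosable H l
  choosable L L-unique L-length =
    let M , L<M = colours-bounded L
        b , d , 1≤b , [b+d]ˡ≤sbˡ , 4tbˡ<Tˡ = reservation-parameters {t} {s} {l} bound
        open Reservation {t} {M} side L
        σ , low = Expectation.low-defect-exists L-unique L-length L<M b d s 1≤b [b+d]ˡ≤sbˡ 4tbˡ<Tˡ
        open LowDefect σ low
    in colour , colour-∈ , colour-proper H uniform side-proper
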